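{- If $H$ is a graph with $|V(H)|\ge 3$, then $\alpha(H)-1\le {\rm tree}\text{ - }\alpha(C(H))\le\alpha(H)$.
   Context: For a graph $H$, the 1-completion $C(H)$ is the graph obtained from $H$ by, for each pair of non-adjacent vertices $u,v$ of $H$, adding a new vertex of degree $2$ adjacent to exactly $u$ and $v$. $\alpha$ denotes the independence number. A tree-decomposition of a graph $G$ is a pair $(T,\{X_t\}_{t\in V(T)})$ where $T$ is a tree and $X_t\subseteq V(G)$, such that every edge of $G$ has both ends in some $X_t$ and for every vertex $v$ the nodes $t$ with $v\in X_t$ induce a non-empty connected subtree of $T$. ${\rm tree}\text{ - }\alpha(G)$ is the minimum over tree-decompositions of $G$ of $\max_t\alpha(G[X_t])$. -}

module Defs where

open import Data.Nat using (ℕ; suc; _≤_)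
open import Data.Fin using (Fin) renaming (_<_ to _<ᶠ_)
open import Data.Bool using (Bool; true; false)
open import Data.List using (List; []; _∷_; _++_; [_]; length)
open import Data.List.Relation.Unary.All using (All)
open import Data.List.Relation.Unary.AllPairs using (AllPairs)
open import Data.List.Relation.Unary.Unique.Propositional using (Unique)
open import Data.List.Relation.Unary.Linked using (Linked)
open import Data.Product using (Σ; ∃; _×_; _,_)
open import Data.Sum using (_⊎_; inj₁; inj₂)
open import Data.Empty using (⊥)
open import Data.Unit using (⊤)
open import Relation.Nullary using (¬_)
open import Relation.Binary.PropositionalEquality using (_≡_)

record SimpleGraph (n : ℕ) : Set where
  field
    adj    : Fin n → Fin n → Bool
    sym    : ∀ u v → adj u v ≡ adj v u
    irrefl : ∀ v → adj v v ≡ false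
open SimpleGraph public

record Graph (V : Set) : Set₁ where
  field
    Adj : V → V → Set
open Graph public

toGraph : ∀ {n} → SimpleGraph n → Graph (Fin n)
Adj (toGraph H) u v = adj H u v ≡ true

record IndepIn {V : Set} (G : Graph V) (X : V → Set) (xs : List V) : Set where
  field
    unique  : Unique xs
    inX     : All X xs
    nonadj  : AllPairs (λ u w → ¬ Adj G u w × ¬ Adj G w u) xs

IsAlphaIn : {V : Set} → Graph V → (V → Set) → ℕ → Set
IsAlphaIn G X a =
  (Σ (List _) λ xs → IndepIn G X xs × length xs ≡ a)
  × (∀ xs → IndepIn G X xs → length xs ≤ a)

IsAlpha : {V : Set} → Graph V → ℕ → Set
IsAlpha G a = IsAlphaIn G (λ _ → ⊤) a

AlphaInAtMost : {V : Set} → Graph V → (V → Set) → ℕ → Set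
AlphaInAtMost G X k = ∀ xs → IndepIn G X xs → length xs ≤ k

AlphaInAtLeast : {V : Set} → Graph V → (V → Set) → ℕ → Set
AlphaInAtLeast G X k = Σ (List _) λ xs → IndepIn G X xs × k ≤ length xs

record NonEdge {n : ℕ} (H : SimpleGraph n) : Set where
  constructor nonEdge
  field
    u v    : Fin n
    u<v    : u <ᶠ v
    nonadj : adj H u v ≡ false
open NonEdge public

CV : ∀ {n} → SimpleGraph n → Set
CV {n} H = Fin n ⊎ NonEdge H

CAdj : ∀ {n} (H : SimpleGraph n) → Fin n ⊎ NonEdge H → Fin n ⊎ NonEdge H → Set
CAdj H (inj₁ x) (inj₁ y) = adj H x y ≡ true
CAdj H (inj₁ x) (inj₂ e) = (x ≡ u e) ⊎ (x ≡ v e)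
CAdj H (inj₂ e) (inj₁ x) = (x ≡ u e) ⊎ (x ≡ v e)
CAdj H (inj₂ _) (inj₂ _) = ⊥

C : ∀ {n} (H : SimpleGraph n) → Graph (CV H)
Adj (C H) = CAdj H

data PathIn {V : Set} (G : Graph V) (P : V → Set) : V → V → Set where
  here : ∀ {x} → P x → PathIn G P x x
  step : ∀ {x y z} → P x → Adj G x y → PathIn G P y z → PathIn G P x z

ConnectedIn : {V : Set} → Graph V → (V → Set) → Set
ConnectedIn G P = ∀ x y → P x → P y → PathIn G P x y

HasCycle : {V : Set} → Graph V → Set
HasCycle {V} G = Σ V λ x → Σ (List V) λ xs →
  Unique (x ∷ xs) × 2 ≤ length xs × Linked (Adj G) (x ∷ xs ++ [ x ])

record IsTree {m : ℕ} (T : Graph (Fin (suc m))) : Set where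
  field
    symm      : ∀ {s t} → Adj T s t → Adj T t s
    loopless  : ∀ {t} → ¬ Adj T t t
    connected : ConnectedIn T (λ _ → ⊤)
    acyclic   : ¬ HasCycle T

record TreeDecomposition {V : Set} (G : Graph V) : Set₁ where
  field
    m        : ℕ
    T        : Graph (Fin (suc m))
    isTree   : IsTree T
    bag      : Fin (suc m) → V → Set
    edgeCov  : ∀ x y → Adj G x y → ∃ λ t → bag t x × bag t y
    vertNonempty : ∀ x → ∃ λ t → bag t x
    vertConn     : ∀ x → ConnectedIn T (λ t → bag t x)
open TreeDecomposition public

TreeAlphaAtMost : {V : Set} → Graph V → ℕ → Set₁
TreeAlphaAtMost G k =
  Σ (TreeDecomposition G) λ D → ∀ t → AlphaInAtMost G (bag D t) k

TreeAlphaAtLeast : {V : Set} → Graph V → ℕ → Set₁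
TreeAlphaAtLeast G k =
  ∀ (D : TreeDecomposition G) → ∃ λ t → AlphaInAtLeast G (bag D t) k

-- Upper bound: C(H) has a star decomposition whose centre bag is V(H) and whose leaf bags are
-- the triangles {x, y, w_xy} of the non-edges xy. The centre has independence number α(H), and a
-- triangle has independence number 2 ≤ α(H).
--
-- Lower bound: fix a maximum independent set I of H and a tree decomposition of C(H), rooted at
-- node 0. For each x, its region is a connected part of the subtree T_x meeting, for every y, the
-- subtree T_w of w = w_xy if xy is a non-edge, and of w = x otherwise; a route inside T_w links it
-- to the region of y. Choose z ∈ I whose region has the deepest highest node t; then t is an
-- ancestor of the whole region of z. For x ∈ I ∖ {z}, t lies on the region of x or on its route
-- to the region of z: otherwise both avoid t, so the region of x lies strictly below t, against
-- the choice of z. Hence the bag of t contains x or w_xz for every x ∈ I ∖ {z}, and these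
-- |I| − 1 vertices are pairwise non-adjacent in C(H).

module Submission where

open import Defs
open import Data.Nat using (ℕ; suc; _≤_; _<_; _∸_; _*_; z≤n; s≤s)
open import Data.Nat.Properties using (≤-refl; ≤-trans; n<1+n; m<n⇒m<1+n; m≤n+m; n≮n; ∸-monoˡ-≤; <-≤-trans)
open import Data.Fin using (Fin; zero; suc; combine; _≟_)
open import Data.Fin.Properties using (combine-injective; <-irrelevant; <⇒≢; <-cmp)
open import Data.Bool using (true; false)
import Data.Bool as Bool
open import Data.List using (List; []; _∷_; _++_; [_]; _∷ʳ_; length; map; concatMap; filter; allFin)
open import Data.List.Properties using (++-assoc; length-++; length-map; filter-all)
open import Data.List.Extrema.Nat using (argmin; argmax; argmin-all; f[argmin]≤f[⊤]; f[argmin]≤f[xs]; f[⊥]≤f[argmax]; f[xs]≤f[argmax])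
open import Data.List.Relation.Unary.All as All using (All; []; _∷_)
open import Data.List.Relation.Unary.All.Properties using (¬Any⇒All¬; ++⁺; ++⁻ˡ; ++⁻ʳ)
import Data.List.Relation.Unary.All.Properties as All
open import Data.List.Relation.Unary.Any using (Any; here; there)
open import Data.List.Relation.Unary.AllPairs as AllPairs using (AllPairs; []; _∷_)
import Data.List.Relation.Unary.AllPairs.Properties as AllPairs
open import Data.List.Relation.Unary.Unique.Propositional using (Unique)
open import Data.List.Relation.Unary.Unique.Propositional.Properties using (Unique[x∷xs]⇒x∉xs)
import Data.List.Relation.Unary.Unique.Propositional.Properties as Unique
open import Data.List.Relation.Unary.Linked using (Linked; []; [-]; _∷_)
open import Data.List.Membership.Propositional using (_∈_; _∉_; lose; find)
open import Data.List.Membership.Propositional.Properties using (∈-∃++; ∈-allFin; ∈-++⁺ˡ; ∈-++⁺ʳ; ∈-map⁺; ∈-concatMap⁺; ∈-concatMap⁻; ∈-filter⁻)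
open import Data.Product using (Σ; ∃; _×_; _,_; proj₁; proj₂; swap)
open import Data.Sum using (_⊎_; inj₁; inj₂)
import Data.Sum as Sum
open import Data.Empty using (⊥; ⊥-elim)
open import Data.Unit using (⊤; tt)
open import Function using (_∘_)
open import Relation.Nullary using (¬_; yes; no; ¬?)
open import Relation.Binary using (tri<; tri≈; tri>)
open import Relation.Binary.PropositionalEquality using (_≡_; _≢_; refl; trans; cong; subst; ≢-sym)
import Relation.Binary.PropositionalEquality as ≡
open import Axiom.UniquenessOfIdentityProofs using (module Decidable⇒UIP)

AllPairs-map-All : ∀ {A : Set} {P : A → Set} {R S : A → A → Set} {xs : List A} →
  (∀ {a b} → P a → P b → R a b → S a b) → All P xs → AllPairs R xs → AllPairs S xs
AllPairs-map-All f [] [] = []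
AllPairs-map-All f (pa ∷ ps) (ra ∷ rs) =
  All.zipWith (λ (pb , r) → f pa pb r) (ps , ra) ∷ AllPairs-map-All f ps rs

AllPairs-truncate : ∀ {A : Set} {R : A → A → Set} {z : A} {ys} xs →
  AllPairs R (xs ++ z ∷ ys) → AllPairs R (xs ∷ʳ z)
AllPairs-truncate [] (_ ∷ _) = [] ∷ []
AllPairs-truncate (x ∷ xs) (rx ∷ rs) =
  ++⁺ (++⁻ˡ xs rx) (All.head (++⁻ʳ xs rx) ∷ []) ∷ AllPairs-truncate xs rs

Linked-retarget : ∀ {A : Set} {R : A → A → Set} {z w : A} {ys} xs →
  Linked R (xs ++ z ∷ ys) → R z w → Linked R (xs ++ z ∷ [ w ])
Linked-retarget [] _ rzw = rzw ∷ [-]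
Linked-retarget (x ∷ []) (rx ∷ l) rzw = rx ∷ Linked-retarget [] l rzw
Linked-retarget (x ∷ x′ ∷ xs) (rx ∷ l) rzw = rx ∷ Linked-retarget (x′ ∷ xs) l rzw

no-three-distinct : ∀ {A : Set} {p q a b c : A} → a ≡ p ⊎ a ≡ q → b ≡ p ⊎ b ≡ q → c ≡ p ⊎ c ≡ q →
  a ≢ b → a ≢ c → b ≢ c → ⊥
no-three-distinct (inj₁ refl) (inj₁ refl) _ a≢b _ _ = a≢b refl
no-three-distinct (inj₂ refl) (inj₂ refl) _ a≢b _ _ = a≢b refl
no-three-distinct (inj₁ refl) (inj₂ refl) (inj₁ refl) _ a≢c _ = a≢c refl
no-three-distinct (inj₁ refl) (inj₂ refl) (inj₂ refl) _ _ b≢c = b≢c refl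
no-three-distinct (inj₂ refl) (inj₁ refl) (inj₁ refl) _ _ b≢c = b≢c refl
no-three-distinct (inj₂ refl) (inj₁ refl) (inj₂ refl) _ a≢c _ = a≢c refl

length-filter-≢ : ∀ {n} (z : Fin n) xs → Unique xs → length xs ≤ suc (length (filter (λ x → ¬? (z ≟ x)) xs))
length-filter-≢ z [] _ = z≤n
length-filter-≢ z (x ∷ xs) (x∉ ∷ u) with z ≟ x
... | yes refl = s≤s (subst (λ ys → length xs ≤ length ys) (≡.sym (filter-all (λ x → ¬? (z ≟ x)) x∉)) ≤-refl)
... | no _ = s≤s (length-filter-≢ z xs u)

NonAdjacent : ∀ {V : Set} → Graph V → V → V → Set
NonAdjacent G x y = ¬ Adj G x y × ¬ Adj G y x

module _ {V : Set} {G : Graph V} {P : V → Set} where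

  nodes : ∀ {x y} → PathIn G P x y → List V
  nodes (here {x} _) = [ x ]
  nodes (step {x} _ _ w) = x ∷ nodes w

  start∈nodes : ∀ {x y} (w : PathIn G P x y) → x ∈ nodes w
  start∈nodes (here _) = here refl
  start∈nodes (step _ _ _) = here refl

  end∈nodes : ∀ {x y} (w : PathIn G P x y) → y ∈ nodes w
  end∈nodes (here _) = here refl
  end∈nodes (step _ _ w) = there (end∈nodes w)

  nodes-in : ∀ {x y} (w : PathIn G P x y) → All P (nodes w)
  nodes-in (here p) = p ∷ []
  nodes-in (step p _ w) = p ∷ nodes-in w

  propagate : ∀ {S Q : V → Set} → (∀ {a b} → Adj G a b → Adj G b a) →
    (∀ {a b} → Adj G a b → S a → S b → Q a → Q b) →
    ∀ {x y} (w : PathIn G P x y) → All S (nodes w) → Any Q (nodes w) → All Q (nodes w)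
  propagate symm carry (here _) _ (here q) = q ∷ []
  propagate symm carry (step _ a w) (sx ∷ sw) (here qx) =
    qx ∷ propagate symm carry w sw (lose (start∈nodes w) (carry a sx (All.lookup sw (start∈nodes w)) qx))
  propagate symm carry (step _ a w) (sx ∷ sw) (there q) =
    carry (symm a) (All.lookup sw (start∈nodes w)) sx (All.lookup qw (start∈nodes w)) ∷ qw
    where qw = propagate symm carry w sw q

module RootedTree {m : ℕ} (T : Graph (Fin (suc m))) (tree : IsTree T) where
  open IsTree tree
  open import Data.List.Membership.DecPropositional (_≟_ {suc m}) using (_∈?_)

  Node : Set
  Node = Fin (suc m)

  root : Node
  root = zero

  infixr 5 _▸_
  data RootPath : Node → List Node → Set where
    done : RootPath root []
    _▸_  : ∀ {x y ys} → Adj T x y → RootPath y ys → RootPath x (y ∷ ys)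

  RootPath-linked : ∀ {x ys} → RootPath x ys → Linked (Adj T) (x ∷ ys)
  RootPath-linked done = [-]
  RootPath-linked (a ▸ r) = a ∷ RootPath-linked r

  root∈RootPath : ∀ {x ys} → RootPath x ys → root ∈ x ∷ ys
  root∈RootPath done = here refl
  root∈RootPath (_ ▸ r) = there (root∈RootPath r)

  chord⇒cycle : ∀ {x y z ys} → Linked (Adj T) (x ∷ y ∷ ys) → Unique (x ∷ y ∷ ys) → z ∈ ys → Adj T z x →
    HasCycle T
  chord⇒cycle {x} {y} {z} l u z∈ys zx with ∈-∃++ z∈ys
  ... | pre , _ , refl = x , y ∷ pre ∷ʳ z , AllPairs-truncate (x ∷ y ∷ pre) u , two≤ ,
        subst (λ zs → Linked (Adj T) (x ∷ y ∷ zs)) (≡.sym (++-assoc pre [ z ] [ x ]))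
              (Linked-retarget (x ∷ y ∷ pre) l zx)
    where
      two≤ : 2 ≤ length (y ∷ pre ∷ʳ z)
      two≤ = s≤s (subst (1 ≤_) (≡.sym (length-++ pre)) (m≤n+m 1 (length pre)))

  RootPath-suffix : ∀ {x t ys} → t ∈ ys → RootPath x ys → Unique (x ∷ ys) →
    ∃ λ zs → RootPath t zs × Unique (t ∷ zs) × length zs < length ys
  RootPath-suffix (here refl) (_ ▸ r) (_ ∷ u) = _ , r , u , n<1+n _
  RootPath-suffix (there t∈) (_ ▸ r) (_ ∷ u) with RootPath-suffix t∈ r u
  ... | zs , r′ , u′ , lt = zs , r′ , u′ , m<n⇒m<1+n lt

  RootPath-unique : ∀ {x ys zs} → RootPath x ys → RootPath x zs → Unique (x ∷ ys) → Unique (x ∷ zs) →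
    ys ≡ zs
  RootPath-unique done done _ _ = refl
  RootPath-unique done (_ ▸ r) _ u = ⊥-elim (Unique[x∷xs]⇒x∉xs u (root∈RootPath r))
  RootPath-unique (_ ▸ r) done u _ = ⊥-elim (Unique[x∷xs]⇒x∉xs u (root∈RootPath r))
  RootPath-unique {x} (_▸_ {y = y} xy r) (_▸_ {y = y′} {ys = zs} xy′ r′) u u′ with y ≟ y′
  ... | yes refl = cong (y ∷_) (RootPath-unique r r′ (AllPairs.tail u) (AllPairs.tail u′))
  ... | no y≢y′ with y ∈? (y′ ∷ zs)
  ...   | yes (here y≡y′) = ⊥-elim (y≢y′ y≡y′)
  ...   | yes (there y∈zs) = ⊥-elim (acyclic (chord⇒cycle (xy′ ∷ RootPath-linked r′) u′ y∈zs (symm xy)))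
  ...   | no y∉ = ⊥-elim (Unique[x∷xs]⇒x∉xs u (there (subst (x ∈_) (≡.sym detour) (here refl))))
    where
      x∉ : x ∉ y ∷ _
      x∉ = Unique[x∷xs]⇒x∉xs u
      y∉detour : y ∉ x ∷ y′ ∷ zs
      y∉detour (here y≡x) = x∉ (here (≡.sym y≡x))
      y∉detour (there y∈) = y∉ y∈
      -- y, x, y′, … is another simple root path of y; by recursion it is the first one, which avoids x.
      detour : _ ≡ x ∷ y′ ∷ zs
      detour = RootPath-unique r (symm xy ▸ xy′ ▸ r′) (AllPairs.tail u) (¬Any⇒All¬ _ y∉detour ∷ u′)

  simple-RootPath : ∀ {P x} → PathIn T P x root → ∃ λ ys → RootPath x ys × Unique (x ∷ ys)
  simple-RootPath (here _) = [] , done , [] ∷ []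
  simple-RootPath {x = x} (step {y = y} _ xy w) with simple-RootPath w
  ... | ys , r , u with x ∈? (y ∷ ys)
  ...   | no x∉ = y ∷ ys , xy ▸ r , ¬Any⇒All¬ _ x∉ ∷ u
  ...   | yes (here refl) = ys , r , u
  ...   | yes (there x∈) with RootPath-suffix x∈ r u
  ...     | zs , r′ , u′ , _ = zs , r′ , u′

  rootPath : Node → List Node
  rootPath x = proj₁ (simple-RootPath (connected x root tt tt))

  rootPath-RootPath : ∀ x → RootPath x (rootPath x)
  rootPath-RootPath x = proj₁ (proj₂ (simple-RootPath (connected x root tt tt)))

  rootPath-Unique : ∀ x → Unique (x ∷ rootPath x)
  rootPath-Unique x = proj₂ (proj₂ (simple-RootPath (connected x root tt tt)))

  RootPath⇒≡rootPath : ∀ {x ys} → RootPath x ys → Unique (x ∷ ys) → ys ≡ rootPath x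
  RootPath⇒≡rootPath {x} r u = RootPath-unique r (rootPath-RootPath x) u (rootPath-Unique x)

  depth : Node → ℕ
  depth x = length (rootPath x)

  infix 4 _≼_
  _≼_ : Node → Node → Set
  t ≼ x = t ∈ x ∷ rootPath x

  ≼∧≢⇒depth< : ∀ {t x} → t ≼ x → t ≢ x → depth t < depth x
  ≼∧≢⇒depth< (here t≡x) t≢x = ⊥-elim (t≢x t≡x)
  ≼∧≢⇒depth< {t} {x} (there t∈) _ with RootPath-suffix t∈ (rootPath-RootPath x) (rootPath-Unique x)
  ... | zs , r , u , lt = subst (λ ys → length ys < depth x) (RootPath⇒≡rootPath r u) lt

  RootPath-edge : ∀ {p q ps qs} → Adj T p q →
    RootPath p ps → Unique (p ∷ ps) → RootPath q qs → Unique (q ∷ qs) → ps ≡ q ∷ qs ⊎ qs ≡ p ∷ ps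
  RootPath-edge {p} {q} {qs = qs} pq rp up rq uq with p ∈? (q ∷ qs)
  ... | no p∉ = inj₁ (RootPath-unique rp (pq ▸ rq) up (¬Any⇒All¬ _ p∉ ∷ uq))
  ... | yes (here refl) = ⊥-elim (loopless pq)
  RootPath-edge pq rp up (_ ▸ rq) uq | yes (there (here refl)) =
    inj₂ (cong (_ ∷_) (RootPath-unique rq rp (AllPairs.tail uq) up))
  RootPath-edge pq rp up (qq′ ▸ rq) uq | yes (there (there p∈)) =
    ⊥-elim (acyclic (chord⇒cycle (qq′ ∷ RootPath-linked rq) uq p∈ pq))

  rootPath-edge : ∀ {p q} → Adj T p q → rootPath p ≡ q ∷ rootPath q ⊎ rootPath q ≡ p ∷ rootPath p
  rootPath-edge {p} {q} pq =
    RootPath-edge pq (rootPath-RootPath p) (rootPath-Unique p) (rootPath-RootPath q) (rootPath-Unique q)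

  ≼-edge : ∀ {p q t} → Adj T p q → t ≢ p → t ≼ p → t ≼ q
  ≼-edge _ t≢p (here t≡p) = ⊥-elim (t≢p t≡p)
  ≼-edge {t = t} pq _ (there t∈) with rootPath-edge pq
  ... | inj₁ p↑q = subst (t ∈_) p↑q t∈
  ... | inj₂ q↑p = there (subst (t ∈_) (≡.sym q↑p) (there t∈))

  ≼-edge-deeper : ∀ {p q t} → Adj T p q → depth t ≤ depth q → t ≼ p → t ≼ q
  ≼-edge-deeper {p} {q} {t} pq t≤q t≼p with t ≟ p
  ... | no t≢p = ≼-edge pq t≢p t≼p
  ... | yes refl with rootPath-edge pq
  ...   | inj₁ p↑q = ⊥-elim (n≮n (depth q) (subst (_≤ depth q) (cong length p↑q) t≤q))
  ...   | inj₂ q↑p = there (subst (t ∈_) (≡.sym q↑p) (here refl))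

  ≼-avoiding : ∀ {P x y t} (w : PathIn T P x y) → t ∉ nodes w → Any (t ≼_) (nodes w) → All (t ≼_) (nodes w)
  ≼-avoiding w t∉ = propagate symm (λ pq t≢p _ → ≼-edge pq t≢p) w (¬Any⇒All¬ _ t∉)

  ≼-deeper : ∀ {P x y t} (w : PathIn T P x y) → All (λ q → depth t ≤ depth q) (nodes w) →
    Any (t ≼_) (nodes w) → All (t ≼_) (nodes w)
  ≼-deeper = propagate symm (λ pq _ t≤q → ≼-edge-deeper pq t≤q)

  module _ {P : Node → Set} {s : Node} where

    walkNodes : List (Σ Node (PathIn T P s)) → List Node
    walkNodes = concatMap (λ w → nodes (proj₂ w))

    span : List (Σ Node (PathIn T P s)) → List Node
    span ws = s ∷ walkNodes ws

    ∈-span⁺ : ∀ ws {w q} → w ∈ ws → q ∈ nodes (proj₂ w) → q ∈ span ws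
    ∈-span⁺ _ w∈ q∈ = there (∈-concatMap⁺ _ (lose w∈ q∈))

    span⊆ : ∀ ws {q} → P s → q ∈ span ws → P q
    span⊆ _ Ps (here refl) = Ps
    span⊆ ws Ps (there q∈) with find (∈-concatMap⁻ _ {xs = ws} q∈)
    ... | (_ , w) , _ , q∈w = All.lookup (nodes-in w) q∈w

    span-constant : ∀ ws {Q : Node → Set} →
      (∀ {w} → w ∈ ws → Any Q (nodes (proj₂ w)) → All Q (nodes (proj₂ w))) →
      ∀ {q q′} → q ∈ span ws → q′ ∈ span ws → Q q → Q q′
    span-constant ws {Q} along q∈ q′∈ Qq = fromStart q′∈ (toStart q∈ Qq)
      where
        toStart : ∀ {q} → q ∈ span ws → Q q → Q s
        toStart (here refl) Qq = Qq
        toStart (there q∈) Qq with find (∈-concatMap⁻ _ {xs = ws} q∈)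
        ... | (_ , w) , w∈ , q∈w = All.lookup (along w∈ (lose q∈w Qq)) (start∈nodes w)
        fromStart : ∀ {q} → q ∈ span ws → Q s → Q q
        fromStart (here refl) Qs = Qs
        fromStart (there q∈) Qs with find (∈-concatMap⁻ _ {xs = ws} q∈)
        ... | (_ , w) , w∈ , q∈w = All.lookup (along w∈ (lose (start∈nodes w) Qs)) q∈w

    highest : List (Σ Node (PathIn T P s)) → Node
    highest ws = argmin depth s (walkNodes ws)

    highest∈span : ∀ ws → highest ws ∈ span ws
    highest∈span ws = argmin-all depth (here refl) (All.tabulate there)

    highest-shallowest : ∀ ws {q} → q ∈ span ws → depth (highest ws) ≤ depth q
    highest-shallowest ws (here refl) = f[argmin]≤f[⊤] {f = depth} s (walkNodes ws)
    highest-shallowest ws (there q∈) = All.lookup (f[argmin]≤f[xs] {f = depth} s (walkNodes ws)) q∈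

    highest-≼ : ∀ ws {q} → q ∈ span ws → highest ws ≼ q
    highest-≼ ws q∈ = span-constant ws along (highest∈span ws) q∈ (here refl)
      where
        along : ∀ {w} → w ∈ ws → Any (highest ws ≼_) (nodes (proj₂ w)) → All (highest ws ≼_) (nodes (proj₂ w))
        along {w} w∈ = ≼-deeper (proj₂ w) (All.tabulate λ q∈w → highest-shallowest ws (∈-span⁺ ws w∈ q∈w))

    depth<highest : ∀ ws {t q} → t ∉ span ws → q ∈ span ws → t ≼ q → depth t < depth (highest ws)
    depth<highest ws {t} t∉ q∈ t≼q =
      ≼∧≢⇒depth< (span-constant ws along q∈ (highest∈span ws) t≼q)
                 (λ t≡h → t∉ (subst (_∈ span ws) (≡.sym t≡h) (highest∈span ws)))
      where
        along : ∀ {w} → w ∈ ws → Any (t ≼_) (nodes (proj₂ w)) → All (t ≼_) (nodes (proj₂ w))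
        along {w} w∈ = ≼-avoiding (proj₂ w) (λ t∈w → t∉ (∈-span⁺ ws w∈ t∈w))

module Completion {n : ℕ} (H : SimpleGraph n) where

  data Joins (e : NonEdge H) (x y : Fin n) : Set where
    uv : u e ≡ x → v e ≡ y → Joins e x y
    vu : u e ≡ y → v e ≡ x → Joins e x y

  Joins-sym : ∀ {e x y} → Joins e x y → Joins e y x
  Joins-sym (uv p q) = vu p q
  Joins-sym (vu p q) = uv p q

  Joins-ends : ∀ {e x y w} → Joins e x y → w ≡ u e ⊎ w ≡ v e → w ≡ x ⊎ w ≡ y
  Joins-ends (uv refl refl) w-end = w-end
  Joins-ends (vu refl refl) w-end = Sum.swap w-end

  Joins⇒Adj : ∀ {e x y} → Joins e x y → Adj (C H) (inj₁ x) (inj₂ e)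
  Joins⇒Adj (uv refl _) = inj₁ refl
  Joins⇒Adj (vu _ refl) = inj₂ refl

  Joins-injective : ∀ {e x y z} → Joins e x z → Joins e y z → x ≢ z → x ≡ y
  Joins-injective (uv refl refl) (uv refl _) _ = refl
  Joins-injective (uv refl refl) (vu refl _) x≢z = ⊥-elim (x≢z refl)
  Joins-injective (vu refl refl) (uv _ refl) x≢z = ⊥-elim (x≢z refl)
  Joins-injective (vu refl refl) (vu _ refl) _ = refl

  nonEdge-joining : ∀ {x y} → x ≢ y → adj H x y ≡ false → Σ (NonEdge H) λ e → Joins e x y
  nonEdge-joining {x} {y} x≢y xy with <-cmp x y
  ... | tri< x<y _ _ = nonEdge x y x<y xy , uv refl refl
  ... | tri≈ _ x≡y _ = ⊥-elim (x≢y x≡y)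
  ... | tri> _ _ y<x = nonEdge y x y<x (trans (sym H y x) xy) , vu refl refl

  Joins⇒¬Adj : ∀ {e x y z} → x ≢ y → x ≢ z → Joins e y z → ¬ Adj (C H) (inj₁ x) (inj₂ e)
  Joins⇒¬Adj x≢y x≢z j x~e with Joins-ends j x~e
  ... | inj₁ x≡y = x≢y x≡y
  ... | inj₂ x≡z = x≢z x≡z

  Proxy : Fin n → Fin n → CV H → Set
  Proxy z x p = p ≡ inj₁ x ⊎ Σ (NonEdge H) λ e → p ≡ inj₂ e × Joins e x z

  proxy-distinct : ∀ {z x y p q} → x ≢ z → x ≢ y → Proxy z x p → Proxy z y q → p ≢ q
  proxy-distinct _ x≢y (inj₁ refl) (inj₁ refl) refl = x≢y refl
  proxy-distinct _ _ (inj₁ refl) (inj₂ (_ , refl , _)) ()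
  proxy-distinct _ _ (inj₂ (_ , refl , _)) (inj₁ refl) ()
  proxy-distinct x≢z x≢y (inj₂ (_ , refl , jx)) (inj₂ (_ , refl , jy)) refl = x≢y (Joins-injective jx jy x≢z)

  proxy-nonadjacent : ∀ {z x y p q} → x ≢ z → y ≢ z → x ≢ y → NonAdjacent (toGraph H) x y →
    Proxy z x p → Proxy z y q → NonAdjacent (C H) p q
  proxy-nonadjacent _ _ _ xy (inj₁ refl) (inj₁ refl) = xy
  proxy-nonadjacent x≢z _ x≢y _ (inj₁ refl) (inj₂ (_ , refl , j)) =
    Joins⇒¬Adj x≢y x≢z j , Joins⇒¬Adj x≢y x≢z j
  proxy-nonadjacent _ y≢z x≢y _ (inj₂ (_ , refl , j)) (inj₁ refl) =
    Joins⇒¬Adj (≢-sym x≢y) y≢z j , Joins⇒¬Adj (≢-sym x≢y) y≢z j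
  proxy-nonadjacent _ _ _ _ (inj₂ (_ , refl , _)) (inj₂ (_ , refl , _)) = (λ ()) , (λ ())

StarAdj : ∀ {k} → Fin (suc k) → Fin (suc k) → Set
StarAdj zero    zero    = ⊥
StarAdj zero    (suc _) = ⊤
StarAdj (suc _) zero    = ⊤
StarAdj (suc _) (suc _) = ⊥

Star : (k : ℕ) → Graph (Fin (suc k))
Adj (Star k) = StarAdj

Star-acyclic : ∀ {k} → ¬ HasCycle (Star k)
Star-acyclic (_ , [] , _ , () , _)
Star-acyclic (_ , _ ∷ [] , _ , s≤s () , _)
Star-acyclic (zero , zero ∷ _ ∷ _ , _ , _ , () ∷ _)
Star-acyclic (zero , suc _ ∷ suc _ ∷ _ , _ , _ , _ ∷ () ∷ _)
Star-acyclic (zero , suc _ ∷ zero ∷ _ , (_ ∷ 0≢0 ∷ _) ∷ _ , _ , _) = 0≢0 refl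
Star-acyclic (suc _ , suc _ ∷ _ ∷ _ , _ , _ , () ∷ _)
Star-acyclic (suc _ , zero ∷ zero ∷ _ , _ , _ , _ ∷ () ∷ _)
Star-acyclic (suc _ , zero ∷ suc _ ∷ [] , _ , _ , _ ∷ _ ∷ () ∷ _)
Star-acyclic (suc _ , zero ∷ suc _ ∷ suc _ ∷ _ , _ , _ , _ ∷ _ ∷ () ∷ _)
Star-acyclic (suc _ , zero ∷ suc _ ∷ zero ∷ _ , _ ∷ (_ ∷ 0≢0 ∷ _) ∷ _ , _ , _) = 0≢0 refl

Star-isTree : ∀ {k} → IsTree (Star k)
IsTree.symm Star-isTree {zero} {suc _} _ = tt
IsTree.symm Star-isTree {suc _} {zero} _ = tt
IsTree.loopless Star-isTree {zero} ()
IsTree.loopless Star-isTree {suc _} ()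
IsTree.connected Star-isTree zero zero _ _ = here tt
IsTree.connected Star-isTree zero (suc _) _ _ = step tt tt (here tt)
IsTree.connected Star-isTree (suc _) zero _ _ = step tt tt (here tt)
IsTree.connected Star-isTree (suc _) (suc _) _ _ = step {y = zero} tt tt (step tt tt (here tt))
IsTree.acyclic Star-isTree = Star-acyclic

module _ {V : Set} (G : Graph V) {k : ℕ} (centre : V → Set) (leaf : Fin k → V → Set) where

  starBag : Fin (suc k) → V → Set
  starBag zero = centre
  starBag (suc i) = leaf i

  starDecomposition :
    (∀ x y → Adj G x y → ∃ λ t → starBag t x × starBag t y) →
    (∀ x → ∃ λ t → starBag t x) →
    (∀ x → centre x ⊎ (∀ {i j} → leaf i x → leaf j x → i ≡ j)) →
    TreeDecomposition G
  starDecomposition covers-edges covers-vertices central-or-single = record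
    { m = k ; T = Star k ; isTree = Star-isTree ; bag = starBag
    ; edgeCov = covers-edges ; vertNonempty = covers-vertices ; vertConn = connected }
    where
      connected : ∀ x → ConnectedIn (Star k) (λ t → starBag t x)
      connected x zero zero x∈ _ = here x∈
      connected x zero (suc _) x∈ x∈′ = step x∈ tt (here x∈′)
      connected x (suc _) zero x∈ x∈′ = step x∈ tt (here x∈′)
      connected x (suc _) (suc _) x∈ x∈′ with central-or-single x
      ... | inj₁ x∈centre = step {y = zero} x∈ tt (step x∈centre tt (here x∈′))
      ... | inj₂ single with single x∈ x∈′
      ...   | refl = here x∈

module UpperBound {n : ℕ} (H : SimpleGraph n) where

  Old : CV H → Set
  Old (inj₁ _) = ⊤
  Old (inj₂ _) = ⊥

  Triangle : NonEdge H → CV H → Set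
  Triangle e x = (x ≡ inj₁ (u e) ⊎ x ≡ inj₁ (v e)) ⊎ x ≡ inj₂ e

  code : NonEdge H → Fin (n * n)
  code e = combine (u e) (v e)

  code-injective : ∀ {e e′} → code e ≡ code e′ → e ≡ e′
  code-injective {nonEdge x y x<y xy} {nonEdge _ _ x<y′ xy′} c with combine-injective x y _ _ c
  ... | refl , refl with <-irrelevant x<y x<y′ | Decidable⇒UIP.≡-irrelevant Bool._≟_ xy xy′
  ...   | refl | refl = refl

  -- Leaves are indexed by Fin (n * n) through code; a leaf that codes no non-edge has an empty bag.
  TriangleBag : Fin (n * n) → CV H → Set
  TriangleBag i x = Σ (NonEdge H) λ e → code e ≡ i × Triangle e x

  decomposition : TreeDecomposition (C H)
  decomposition = starDecomposition (C H) Old TriangleBag covers-edges covers-vertices central-or-single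
    where
      Bag = starBag (C H) Old TriangleBag

      end : ∀ {x e} → x ≡ u e ⊎ x ≡ v e → Triangle e (inj₁ x)
      end = inj₁ ∘ Sum.map (cong inj₁) (cong inj₁)

      covers-edges : ∀ x y → Adj (C H) x y → ∃ λ t → Bag t x × Bag t y
      covers-edges (inj₁ _) (inj₁ _) _ = zero , tt , tt
      covers-edges (inj₁ _) (inj₂ e) x~e = suc (code e) , (e , refl , end x~e) , (e , refl , inj₂ refl)
      covers-edges (inj₂ e) (inj₁ _) e~x = suc (code e) , (e , refl , inj₂ refl) , (e , refl , end e~x)

      covers-vertices : ∀ x → ∃ λ t → Bag t x
      covers-vertices (inj₁ _) = zero , tt
      covers-vertices (inj₂ e) = suc (code e) , e , refl , inj₂ refl

      hub : ∀ {e e′} → Triangle e′ (inj₂ e) → e′ ≡ e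
      hub (inj₁ (inj₁ ()))
      hub (inj₁ (inj₂ ()))
      hub (inj₂ refl) = refl

      central-or-single : ∀ x → Old x ⊎ (∀ {i j} → TriangleBag i x → TriangleBag j x → i ≡ j)
      central-or-single (inj₁ _) = inj₁ tt
      central-or-single (inj₂ e) =
        inj₂ λ { (_ , refl , t) (_ , refl , t′) → cong code (trans (hub t) (≡.sym (hub t′))) }

  old-vertices : ∀ xs → All Old xs → ∃ λ ys → xs ≡ map inj₁ ys
  old-vertices [] [] = [] , refl
  old-vertices (inj₁ y ∷ xs) (_ ∷ old) with old-vertices xs old
  ... | ys , refl = y ∷ ys , refl

  Triangle⇒old : ∀ {e x y} → Triangle e x → Triangle e y → x ≢ y → NonAdjacent (C H) x y →
    x ≡ inj₁ (u e) ⊎ x ≡ inj₁ (v e)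
  Triangle⇒old (inj₁ old) _ _ _ = old
  Triangle⇒old (inj₂ refl) (inj₁ (inj₁ refl)) _ (x≁y , _) = ⊥-elim (x≁y (inj₁ refl))
  Triangle⇒old (inj₂ refl) (inj₁ (inj₂ refl)) _ (x≁y , _) = ⊥-elim (x≁y (inj₂ refl))
  Triangle⇒old (inj₂ refl) (inj₂ refl) x≢y _ = ⊥-elim (x≢y refl)

  triangle-bound : ∀ {e} xs → Unique xs → All (Triangle e) xs → AllPairs (NonAdjacent (C H)) xs → length xs ≤ 2
  triangle-bound [] _ _ _ = z≤n
  triangle-bound (_ ∷ []) _ _ _ = s≤s z≤n
  triangle-bound (_ ∷ _ ∷ []) _ _ _ = s≤s (s≤s z≤n)
  triangle-bound (_ ∷ _ ∷ _ ∷ _) ((x₁≢x₂ ∷ x₁≢x₃ ∷ _) ∷ (x₂≢x₃ ∷ _) ∷ _) (t₁ ∷ t₂ ∷ t₃ ∷ _)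
                 ((x₁≁x₂ ∷ x₁≁x₃ ∷ _) ∷ _) =
    ⊥-elim (no-three-distinct old₁ old₂ old₃ x₁≢x₂ x₁≢x₃ x₂≢x₃)
    where
      old₁ = Triangle⇒old t₁ t₂ x₁≢x₂ x₁≁x₂
      old₂ = Triangle⇒old t₂ t₁ (≢-sym x₁≢x₂) (swap x₁≁x₂)
      old₃ = Triangle⇒old t₃ t₁ (≢-sym x₁≢x₃) (swap x₁≁x₃)

  module _ {a : ℕ} (α≤a : AlphaInAtMost (toGraph H) (λ _ → ⊤) a) where

    nonEdge⇒2≤α : NonEdge H → 2 ≤ a
    nonEdge⇒2≤α e = α≤a (u e ∷ v e ∷ []) record
      { unique = (<⇒≢ (u<v e) ∷ []) ∷ [] ∷ []
      ; inX = tt ∷ tt ∷ []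
      ; nonadj = ((false≢true (nonadj e) , false≢true (trans (sym H (v e) (u e)) (nonadj e))) ∷ []) ∷ [] ∷ []
      }
      where
        false≢true : ∀ {b} → b ≡ false → b ≢ true
        false≢true refl ()

    Old-bound : AlphaInAtMost (C H) Old a
    Old-bound xs I with old-vertices xs (IndepIn.inX I)
    ... | ys , refl = subst (_≤ a) (≡.sym (length-map inj₁ ys)) (α≤a ys record
      { unique = Unique.map⁻ (IndepIn.unique I)
      ; inX = All.universal (λ _ → tt) ys
      ; nonadj = AllPairs.map⁻ (IndepIn.nonadj I)
      })

    TriangleBag-bound : ∀ i → AlphaInAtMost (C H) (TriangleBag i) a
    TriangleBag-bound i [] _ = z≤n
    TriangleBag-bound i xs@(_ ∷ _) I with IndepIn.inX I
    ... | (e , refl , _) ∷ _ =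
      ≤-trans (triangle-bound xs (IndepIn.unique I) (All.map same-triangle (IndepIn.inX I)) (IndepIn.nonadj I))
              (nonEdge⇒2≤α e)
      where
        same-triangle : ∀ {x} → TriangleBag (code e) x → Triangle e x
        same-triangle (_ , c , t) = subst (λ f → Triangle f _) (code-injective c) t

    upperBound : TreeAlphaAtMost (C H) a
    upperBound = decomposition , λ { zero → Old-bound ; (suc i) → TriangleBag-bound i }

module LowerBound {n : ℕ} {H : SimpleGraph n} (D : TreeDecomposition (C H)) where
  open Completion H
  open RootedTree (T D) (isTree D)
  open import Data.List.Membership.DecPropositional (_≟_ {suc (m D)}) using (_∈?_)

  home : Fin n → Node
  home x = proj₁ (vertNonempty D (inj₁ x))

  home∈ : ∀ x → bag D (home x) (inj₁ x)
  home∈ x = proj₂ (vertNonempty D (inj₁ x))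

  record Link (x y : Fin n) : Set where
    field
      via       : CV H
      via-proxy : Proxy y x via
      from      : Node
      from∋x    : bag D from (inj₁ x)
      to        : Node
      to∋y      : bag D to (inj₁ y)
      route     : PathIn (T D) (λ s → bag D s via) from to
  open Link

  link : ∀ x y → Link x y
  link x y with x ≟ y
  ... | yes refl = record
    { via = inj₁ x ; via-proxy = inj₁ refl
    ; from = home x ; from∋x = home∈ x ; to = home x ; to∋y = home∈ x ; route = here (home∈ x) }
  ... | no x≢y with adj H x y in xy
  ...   | true = let (s , x∈s , y∈s) = edgeCov D (inj₁ x) (inj₁ y) xy in record
    { via = inj₁ x ; via-proxy = inj₁ refl
    ; from = s ; from∋x = x∈s ; to = s ; to∋y = y∈s ; route = here x∈s }
  ...   | false = let (e , j) = nonEdge-joining x≢y xy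
                      (s , x∈s , e∈s) = edgeCov D (inj₁ x) (inj₂ e) (Joins⇒Adj j)
                      (s′ , y∈s′ , e∈s′) = edgeCov D (inj₁ y) (inj₂ e) (Joins⇒Adj (Joins-sym j)) in record
    { via = inj₂ e ; via-proxy = inj₂ (e , refl , j)
    ; from = s ; from∋x = x∈s ; to = s′ ; to∋y = y∈s′ ; route = vertConn D (inj₂ e) s s′ e∈s e∈s′ }

  Walk : Fin n → Set
  Walk x = Σ Node (PathIn (T D) (λ s → bag D s (inj₁ x)) (home x))

  walkTo : ∀ {x s} → bag D s (inj₁ x) → Walk x
  walkTo {x} {s} x∈s = s , vertConn D (inj₁ x) (home x) s (home∈ x) x∈s

  walks : ∀ x → List (Walk x)
  walks x = map (λ y → walkTo (from∋x (link x y))) (allFin n)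
         ++ map (λ y → walkTo (to∋y (link y x))) (allFin n)

  region : Fin n → List Node
  region x = span (walks x)

  from∈region : ∀ x y → from (link x y) ∈ region x
  from∈region x y =
    ∈-span⁺ (walks x) (∈-++⁺ˡ (∈-map⁺ (λ y → walkTo (from∋x (link x y))) (∈-allFin y))) (end∈nodes _)

  to∈region : ∀ x y → to (link x y) ∈ region y
  to∈region x y =
    ∈-span⁺ (walks y) (∈-++⁺ʳ _ (∈-map⁺ (λ x → walkTo (to∋y (link x y))) (∈-allFin x))) (end∈nodes _)

  topDepth : Fin n → ℕ
  topDepth x = depth (highest (walks x))

  module DeepestRegion (I : List (Fin n)) (z : Fin n) (z-deepest : ∀ {x} → x ∈ I → topDepth x ≤ topDepth z) where

    t : Node
    t = highest (walks z)

    t-unavoidable : ∀ {x} → x ∈ I → t ∉ region x → t ∉ nodes (route (link x z)) → ⊥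
    t-unavoidable {x} x∈I t∉region t∉route = n≮n (depth t) (<-≤-trans t-above-region (z-deepest x∈I))
      where
        r = route (link x z)
        t≼from : t ≼ from (link x z)
        t≼from = All.lookup (≼-avoiding r t∉route (lose (end∈nodes r) (highest-≼ (walks z) (to∈region x z))))
                            (start∈nodes r)
        t-above-region : depth t < topDepth x
        t-above-region = depth<highest (walks x) t∉region (from∈region x z) t≼from

    pick : Fin n → CV H
    pick x with t ∈? region x
    ... | yes _ = inj₁ x
    ... | no _ = via (link x z)

    pick-proxy : ∀ x → Proxy z x (pick x)
    pick-proxy x with t ∈? region x
    ... | yes _ = inj₁ refl
    ... | no _ = via-proxy (link x z)

    pick∈bag : ∀ {x} → x ∈ I → bag D t (pick x)
    pick∈bag {x} x∈I with t ∈? region x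
    ... | yes t∈region = span⊆ (walks x) (home∈ x) t∈region
    ... | no t∉region with t ∈? nodes (route (link x z))
    ...   | yes t∈route = All.lookup (nodes-in (route (link x z))) t∈route
    ...   | no t∉route = ⊥-elim (t-unavoidable x∈I t∉region t∉route)

    module _ (indep : IndepIn (toGraph H) (λ _ → ⊤) I) where

      others : List (Fin n)
      others = filter (λ x → ¬? (z ≟ x)) I

      others-spec : All (λ x → x ∈ I × x ≢ z) others
      others-spec = All.tabulate λ x∈ → let (x∈I , z≢x) = ∈-filter⁻ (λ x → ¬? (z ≟ x)) x∈ in x∈I , ≢-sym z≢x

      others-indep : AllPairs (λ x y → x ≢ y × NonAdjacent (toGraph H) x y) others
      others-indep = AllPairs.zip (AllPairs.filter⁺ _ (IndepIn.unique indep) , AllPairs.filter⁺ _ (IndepIn.nonadj indep))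

      proxies : IndepIn (C H) (bag D t) (map pick others)
      proxies = record
        { unique = AllPairs.map⁺ (AllPairs-map-All
            (λ (_ , x≢z) _ (x≢y , _) → proxy-distinct x≢z x≢y (pick-proxy _) (pick-proxy _))
            others-spec others-indep)
        ; inX = All.map⁺ (All.map (λ (x∈I , _) → pick∈bag x∈I) others-spec)
        ; nonadj = AllPairs.map⁺ (AllPairs-map-All
            (λ (_ , x≢z) (_ , y≢z) (x≢y , x≁y) → proxy-nonadjacent x≢z y≢z x≢y x≁y (pick-proxy _) (pick-proxy _))
            others-spec others-indep)
        }

      proxies-length : length I ∸ 1 ≤ length (map pick others)
      proxies-length = subst (length I ∸ 1 ≤_) (≡.sym (length-map pick others))
        (∸-monoˡ-≤ 1 (length-filter-≢ z I (IndepIn.unique indep)))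

  lowerBound : ∀ I → IndepIn (toGraph H) (λ _ → ⊤) I →
    ∃ λ t → AlphaInAtLeast (C H) (bag D t) (length I ∸ 1)
  lowerBound [] _ = zero , [] , record { unique = [] ; inX = [] ; nonadj = [] } , z≤n
  lowerBound I@(i ∷ is) indep = t , map pick (others indep) , proxies indep , proxies-length indep
    where
      z : Fin n
      z = argmax topDepth i is
      z-deepest : ∀ {x} → x ∈ I → topDepth x ≤ topDepth z
      z-deepest (here refl) = f[⊥]≤f[argmax] {f = topDepth} i is
      z-deepest (there x∈) = All.lookup (f[xs]≤f[argmax] {f = topDepth} i is) x∈
      open DeepestRegion I z z-deepest

lemma2p4 : ∀ (n : ℕ) (H : SimpleGraph n) → 3 ≤ n → ∀ (a : ℕ) → IsAlpha (toGraph H) a →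
    TreeAlphaAtLeast (C H) (a ∸ 1) × TreeAlphaAtMost (C H) a
lemma2p4 n H _ a ((I , indep , refl) , maximum) =
  (λ D → LowerBound.lowerBound D I indep) , UpperBound.upperBound H maximum
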